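{- Let $n \ge 1$. Define $F_0(k) = k$ for $1 \le k \le 2^n$, and for $1 \le q \le n$ define $F_q(k)$ for $1 \le k \le 2^n$ inductively by $F_q(1) = 0$ and, for $k \ge 2$, $F_q(k) = \max_{1 \le k' \le k/2}\bigl(F_q(k') + F_q(k-k') + F_{q-1}(k')\bigr)$. Then for all $1 \le q \le n$ and $1 \le k \le 2^n$, $F_q(k) = \sum_{i=0}^{k-1} h_q(i)$.
   Context: For $i \in [0:2^n-1]$, $h(i)$ denotes the number of ones in the binary representation of $i$, and $h_q(i) = \binom{h(i)}{q}$ (with $\binom{m}{q} = 0$ if $q > m$). -}

module Defs where

open import Data.Nat using (ℕ; zero; suc; _+_; _∸_; _⊔_; _/_)
open import Data.Nat.Combinatorics using (_C_)
open import Data.List using (List; map; foldr; upTo)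
open import Data.Nat.ListAction using (sum)

-- h i : number of ones in the binary representation of i
-- (defined by recursion on a fuel bound ≥ i)
popcount-fuel : ℕ → ℕ → ℕ
popcount-fuel zero i = 0
popcount-fuel (suc f) zero = 0
popcount-fuel (suc f) (suc i) with suc i Data.Nat.% 2
... | r = r + popcount-fuel f (suc i / 2)

h : ℕ → ℕ
h i = popcount-fuel i i

hq : ℕ → ℕ → ℕ
hq q i = h i C q

maxL : List ℕ → ℕ
maxL = foldr _⊔_ 0

-- Fuel-based version of the recursion; Ff q fuel k is meant with fuel = k.
-- F_0(k) = k ; F_q(1) = 0 ; F_q(k) = max_{1 ≤ k' ≤ k/2} (F_q(k') + F_q(k-k') + F_{q-1}(k')) for k ≥ 2.
Ff : ℕ → ℕ → ℕ → ℕ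
Ff zero fuel k = k
Ff (suc q) zero k = 0
Ff (suc q) (suc fuel) zero = 0
Ff (suc q) (suc fuel) (suc zero) = 0
Ff (suc q) (suc fuel) (suc (suc m)) =
  maxL (map (λ j → let k' = suc j in
                   Ff (suc q) fuel k' + Ff (suc q) fuel (k ∸ k') + Ff q fuel k')
            (upTo (k / 2)))
  where k = suc (suc m)

F : ℕ → ℕ → ℕ
F q k = Ff q k k

sumTo : ℕ → (ℕ → ℕ) → ℕ
sumTo k f = sum (map f (upTo k))

-- Write S_q(k) = Σ_{i<k} h_q(i), here Σh q k, with Σh⁻ q k = S_{q-1}(k). Since h(2i) = h(i) and
-- h(2i+1) = h(i) + 1, Pascal's rule gives S_q(l + r) = S_q(l) + S_q(r) + S_{q-1}(l) for the halves
-- l = ⌊k/2⌋, r = ⌈k/2⌉ of k, so the split k' = ⌊k/2⌋ realises S_q(k) in the recursion for F_q.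
-- No split does better: S_q(a) + S_q(b) + S_{q-1}(a) ≤ S_q(a + b) for a ≤ b, by induction on q
-- and, inside, on a + b. Expanding a, b and a + b into halves reduces it to two instances for pairs
-- of halves (whose sums are the halves of a + b) and one instance for q - 1.
module Submission where

open import Defs
open import Data.Nat using (ℕ; zero; suc; _+_; _*_; _∸_; _/_; _%_; _≤_; _<_; _^_; z≤n; s≤s; s≤s⁻¹; z<s)
open import Data.Nat.Properties
open import Data.Nat.DivMod using (m*n/n≡m; m*n%n≡0; [m+kn]%n≡m%n; +-distrib-/; m/n<m)
open import Data.Nat.Combinatorics using (_C_; nCk+nC[k+1]≡[n+1]C[k+1])
open import Data.Nat.ListAction using (sum)
open import Data.Nat.ListAction.Properties using (sum-++)
open import Data.Nat.Tactic.RingSolver using (solve-∀)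
open import Data.List using ([]; _∷_; [_]; _++_; map; upTo)
open import Data.List.Properties using (map-++; upTo-∷ʳ)
open import Data.List.Relation.Unary.All using (All; []; _∷_)
import Data.List.Relation.Unary.All.Properties as All
open import Data.List.Relation.Unary.Any using (here; there)
open import Data.List.Membership.Propositional using (_∈_)
open import Data.List.Membership.Propositional.Properties using (∈-map⁺; ∈-upTo⁺)
open import Data.Product using (∃-syntax; _×_; _,_)
open import Data.Sum using (inj₁; inj₂)
open import Function using (id; _∘_)
open import Relation.Binary.PropositionalEquality
  using (_≡_; refl; sym; trans; cong; cong₂; subst; module ≡-Reasoning)

sumBelow : ℕ → (ℕ → ℕ) → ℕ
sumBelow zero    f = 0
sumBelow (suc k) f = sumBelow k f + f k

sumTo≡sumBelow : ∀ k f → sumTo k f ≡ sumBelow k f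
sumTo≡sumBelow zero    f = refl
sumTo≡sumBelow (suc k) f = begin
  sum (map f (upTo (suc k)))       ≡⟨ cong (sum ∘ map f) (upTo-∷ʳ k) ⟨
  sum (map f (upTo k ++ [ k ]))    ≡⟨ cong sum (map-++ f (upTo k) [ k ]) ⟩
  sum (map f (upTo k) ++ [ f k ])  ≡⟨ sum-++ (map f (upTo k)) [ f k ] ⟩
  sumTo k f + (f k + 0)            ≡⟨ cong₂ _+_ (sumTo≡sumBelow k f) (+-identityʳ (f k)) ⟩
  sumBelow k f + f k               ∎
  where open ≡-Reasoning

sumBelow-cong : ∀ k {f g} → (∀ i → f i ≡ g i) → sumBelow k f ≡ sumBelow k g
sumBelow-cong zero    f≡g = refl
sumBelow-cong (suc k) f≡g = cong₂ _+_ (sumBelow-cong k f≡g) (f≡g k)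

sumBelow-distrib-+ : ∀ k f g → sumBelow k (λ i → f i + g i) ≡ sumBelow k f + sumBelow k g
sumBelow-distrib-+ zero    f g = refl
sumBelow-distrib-+ (suc k) f g = trans (cong (_+ (f k + g k)) (sumBelow-distrib-+ k f g))
                                       (+-+-interchange (sumBelow k f) (sumBelow k g) (f k) (g k))
  where
  +-+-interchange : ∀ a b c d → (a + b) + (c + d) ≡ (a + c) + (b + d)
  +-+-interchange = solve-∀

sumBelow-double : ∀ t f →
  sumBelow (t + t) f ≡ sumBelow t (λ i → f (i + i)) + sumBelow t (λ i → f (suc (i + i)))
sumBelow-double zero    f = refl
sumBelow-double (suc t) f rewrite +-suc t t | sumBelow-double t f =
  regroup (sumBelow t (λ i → f (i + i))) (sumBelow t (λ i → f (suc (i + i))))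
          (f (t + t)) (f (suc (t + t)))
  where
  regroup : ∀ e o x y → e + o + x + y ≡ (e + x) + (o + y)
  regroup = solve-∀

data Halves : ℕ → Set where
  even : ∀ x → Halves (x + x)
  odd  : ∀ x → Halves (suc (x + x))

halves : ∀ n → Halves n
halves zero = even 0
halves (suc n) with halves n
... | even x = odd x
... | odd x  = subst Halves (cong suc (+-suc x x)) (even (suc x))

lo hi : ∀ {n} → Halves n → ℕ
lo (even x) = x
lo (odd x)  = x
hi (even x) = x
hi (odd x)  = suc x

lo≤hi : ∀ {n} (v : Halves n) → lo v ≤ hi v
lo≤hi (even x) = ≤-refl
lo≤hi (odd x)  = n≤1+n x

lo+hi≡ : ∀ {n} (v : Halves n) → lo v + hi v ≡ n
lo+hi≡ (even x) = refl
lo+hi≡ (odd x)  = +-suc x x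

lo+lo≤ : ∀ {n} (v : Halves n) → lo v + lo v ≤ n
lo+lo≤ v = subst (lo v + lo v ≤_) (lo+hi≡ v) (+-monoʳ-≤ (lo v) (lo≤hi v))

hi<self : ∀ {n} (v : Halves n) → 2 ≤ n → hi v < n
hi<self (even (suc x)) _ = m<m+n (suc x) z<s
hi<self (odd zero)     (s≤s ())
hi<self (odd (suc x))  _ = s≤s (m<m+n (suc x) z<s)

double≡*2 : ∀ x → x + x ≡ x * 2
double≡*2 = solve-∀

/2≡lo : ∀ {n} (v : Halves n) → n / 2 ≡ lo v
/2≡lo (even x) = trans (cong (_/ 2) (double≡*2 x)) (m*n/n≡m x 2)
/2≡lo (odd x)  = begin
  (1 + x + x) / 2        ≡⟨ cong (λ m → (1 + m) / 2) (double≡*2 x) ⟩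
  (1 + x * 2) / 2        ≡⟨ +-distrib-/ 1 (x * 2) (subst (λ r → 1 + r < 2) (sym (m*n%n≡0 x 2)) ≤-refl) ⟩
  0 + x * 2 / 2          ≡⟨ m*n/n≡m x 2 ⟩
  x                      ∎
  where open ≡-Reasoning

double-cancel-≤ : ∀ {x y} → x + x ≤ y + y → x ≤ y
double-cancel-≤ x+x≤y+y = ≮⇒≥ (λ y<x → <⇒≱ (+-mono-< y<x y<x) x+x≤y+y)

double-cancel-< : ∀ {x y} → x + x < y + y → x < y
double-cancel-< x+x<y+y = ≰⇒> (λ y≤x → <⇒≱ x+x<y+y (+-mono-≤ y≤x y≤x))

popcount-fuel-0 : ∀ f → popcount-fuel f 0 ≡ 0
popcount-fuel-0 zero    = refl
popcount-fuel-0 (suc f) = refl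

popcount-fuel-irrelevant : ∀ {f g} i → i ≤ f → i ≤ g → popcount-fuel f i ≡ popcount-fuel g i
popcount-fuel-irrelevant {f} {g} zero _ _ = trans (popcount-fuel-0 f) (sym (popcount-fuel-0 g))
popcount-fuel-irrelevant {suc f} {suc g} (suc i) (s≤s i≤f) (s≤s i≤g) =
  cong (suc i % 2 +_) (popcount-fuel-irrelevant (suc i / 2) (≤-trans half≤i i≤f) (≤-trans half≤i i≤g))
  where
  half≤i : suc i / 2 ≤ i
  half≤i = s≤s⁻¹ (m/n<m (suc i) 2 ≤-refl)

h-double : ∀ x → h (x + x) ≡ h x
h-double zero    = refl
h-double (suc x) = cong₂ _+_ even%2 (trans (cong (popcount-fuel (x + suc x)) (/2≡lo (even (suc x))))
                                           (popcount-fuel-irrelevant (suc x) (m≤n+m (suc x) x) ≤-refl))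
  where
  even%2 : (suc x + suc x) % 2 ≡ 0
  even%2 = trans (cong (_% 2) (double≡*2 (suc x))) (m*n%n≡0 (suc x) 2)

h-suc-double : ∀ x → h (suc (x + x)) ≡ suc (h x)
h-suc-double x = cong₂ _+_ odd%2 (trans (cong (popcount-fuel (x + x)) (/2≡lo (odd x)))
                                        (popcount-fuel-irrelevant x (m≤m+n x x) ≤-refl))
  where
  odd%2 : suc (x + x) % 2 ≡ 1
  odd%2 = trans (cong (λ m → (1 + m) % 2) (double≡*2 x)) ([m+kn]%n≡m%n 1 x 2)

_C⁻_ : ℕ → ℕ → ℕ
x C⁻ zero  = 0
x C⁻ suc q = x C q

C-pascal : ∀ x q → suc x C q ≡ x C q + x C⁻ q
C-pascal x zero    = refl
C-pascal x (suc q) = trans (sym (nCk+nC[k+1]≡[n+1]C[k+1] x q)) (+-comm (x C q) (x C suc q))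

Σh Σh⁻ : ℕ → ℕ → ℕ
Σh  q k = sumBelow k (hq q)
Σh⁻ q k = sumBelow k (λ i → h i C⁻ q)

Σh-0 : ∀ k → Σh 0 k ≡ k
Σh-0 zero    = refl
Σh-0 (suc k) = trans (cong (_+ 1) (Σh-0 k)) (+-comm k 1)

Σh⁻-0 : ∀ k → Σh⁻ 0 k ≡ 0
Σh⁻-0 zero    = refl
Σh⁻-0 (suc k) = trans (+-identityʳ (Σh⁻ 0 k)) (Σh⁻-0 k)

Σh-double : ∀ q t → Σh q (t + t) ≡ Σh q t + Σh q t + Σh⁻ q t
Σh-double q t = begin
  Σh q (t + t)
    ≡⟨ sumBelow-double t (hq q) ⟩
  sumBelow t (λ i → h (i + i) C q) + sumBelow t (λ i → h (suc (i + i)) C q)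
    ≡⟨ cong₂ _+_ (sumBelow-cong t (λ i → cong (_C q) (h-double i)))
                 (sumBelow-cong t (λ i → trans (cong (_C q) (h-suc-double i)) (C-pascal (h i) q))) ⟩
  Σh q t + sumBelow t (λ i → hq q i + h i C⁻ q)
    ≡⟨ cong (Σh q t +_) (sumBelow-distrib-+ t (hq q) (λ i → h i C⁻ q)) ⟩
  Σh q t + (Σh q t + Σh⁻ q t)
    ≡⟨ +-assoc (Σh q t) (Σh q t) (Σh⁻ q t) ⟨
  Σh q t + Σh q t + Σh⁻ q t
    ∎
  where open ≡-Reasoning

Σh-suc-double : ∀ q t → Σh q (suc (t + t)) ≡ Σh q t + Σh q (suc t) + Σh⁻ q t
Σh-suc-double q t = trans (cong₂ _+_ (Σh-double q t) (cong (_C q) (h-double t)))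
                          (regroup (Σh q t) (Σh⁻ q t) (hq q t))
  where
  regroup : ∀ s s⁻ x → s + s + s⁻ + x ≡ s + (s + x) + s⁻
  regroup = solve-∀

Σh-halves : ∀ q {n} (v : Halves n) → Σh q n ≡ Σh q (lo v) + Σh q (hi v) + Σh⁻ q (lo v)
Σh-halves q (even x) = Σh-double q x
Σh-halves q (odd x)  = Σh-suc-double q x

Σh-mono-suc : ∀ q k → Σh q k ≤ Σh q (suc k)
Σh-mono-suc q k = m≤m+n (Σh q k) (hq q k)

-- U = Σh p below stands for Σh⁻ (suc p), to which it is definitionally equal.
module SplitStep (p : ℕ)
  (split-p : ∀ {a b c} → a + b ≡ c → a ≤ b → Σh p a + Σh p b + Σh⁻ p a ≤ Σh p c) where

  T U V : ℕ → ℕ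
  T = Σh (suc p)
  U = Σh p
  V = Σh⁻ p

  split-≤ : ∀ n {a b c} → a + b ≡ c → c ≤ n → a ≤ b → T a + T b + U a ≤ T c

  pair-up : ∀ n {a b c c′} (va : Halves a) (vc : Halves c′) b₁ b₂ w →
    c′ ≡ c → 2 ≤ c → c ≤ suc n →
    T b ≡ T b₁ + T b₂ + U w →
    lo va + b₁ ≡ lo vc → lo va ≤ b₁ →
    hi va + b₂ ≡ hi vc → hi va ≤ b₂ →
    U (lo va) + U w + V (lo va) ≤ U (lo vc) →
    T a + T b + U a ≤ T c
  pair-up n {a} {b} {c} va vc b₁ b₂ w refl 2≤c c≤1+n Tb sum₁ ord₁ sum₂ ord₂ rest = begin
    T a + T b + U a
      ≡⟨ cong₂ _+_ (cong₂ _+_ (Σh-halves (suc p) va) Tb) (Σh-halves p va) ⟩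
    (T a₁ + T a₂ + U a₁) + (T b₁ + T b₂ + U w) + (U a₁ + U a₂ + V a₁)
      ≡⟨ regroup (T a₁) (T a₂) (T b₁) (T b₂) (U a₁) (U a₂) (U w) (V a₁) ⟩
    (T a₁ + T b₁ + U a₁) + (T a₂ + T b₂ + U a₂) + (U a₁ + U w + V a₁)
      ≤⟨ +-mono-≤ (+-mono-≤ (split-≤ n sum₁ lo≤n ord₁) (split-≤ n sum₂ hi≤n ord₂)) rest ⟩
    T (lo vc) + T (hi vc) + U (lo vc)
      ≡⟨ Σh-halves (suc p) vc ⟨
    T c
      ∎
    where
    open ≤-Reasoning
    a₁ = lo va
    a₂ = hi va
    hi≤n : hi vc ≤ n
    hi≤n = s≤s⁻¹ (≤-trans (hi<self vc 2≤c) c≤1+n)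
    lo≤n : lo vc ≤ n
    lo≤n = ≤-trans (lo≤hi vc) hi≤n
    regroup : ∀ A₁ A₂ B₁ B₂ U₁ U₂ W V₁ →
      (A₁ + A₂ + U₁) + (B₁ + B₂ + W) + (U₁ + U₂ + V₁) ≡
      (A₁ + B₁ + U₁) + (A₂ + B₂ + U₂) + (U₁ + W + V₁)
    regroup = solve-∀

  split-< : ∀ n {a b c} → Halves a → Halves b → a + b ≡ c → 2 ≤ c → c ≤ suc n → a < b →
    T a + T b + U a ≤ T c
  split-< n (even x) (even y) e 2≤c c≤ a<b =
    pair-up n {b = y + y} (even x) (even (x + y)) y y y (trans (swap x y) e) 2≤c c≤
      (Σh-double (suc p) y) refl x≤y refl x≤y (split-p refl x≤y)
    where
    x≤y = <⇒≤ (double-cancel-< a<b)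
    swap : ∀ x y → (x + y) + (x + y) ≡ (x + x) + (y + y)
    swap = solve-∀
  split-< n (even x) (odd y) e 2≤c c≤ a<b =
    pair-up n {b = suc (y + y)} (even x) (odd (x + y)) y (suc y) y (trans (swap x y) e) 2≤c c≤
      (Σh-suc-double (suc p) y) refl x≤y (+-suc x y) (m≤n⇒m≤1+n x≤y) (split-p refl x≤y)
    where
    x≤y = double-cancel-≤ (m<1+n⇒m≤n a<b)
    swap : ∀ x y → suc ((x + y) + (x + y)) ≡ (x + x) + suc (y + y)
    swap = solve-∀
  split-< n (odd x) (even y) e 2≤c c≤ a<b =
    pair-up n {b = y + y} (odd x) (odd (x + y)) y y y (trans (swap x y) e) 2≤c c≤
      (Σh-double (suc p) y) refl (<⇒≤ x<y) refl x<y (split-p refl (<⇒≤ x<y))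
    where
    x<y = double-cancel-< (<-trans (n<1+n _) a<b)
    swap : ∀ x y → suc ((x + y) + (x + y)) ≡ suc (x + x) + (y + y)
    swap = solve-∀
  -- Pairing crosswise, (x, y + 1) and (x + 1, y), makes both pair sums the halves of a + b.
  split-< n (odd x) (odd y) e 2≤c c≤ a<b =
    pair-up n {b = suc (y + y)} (odd x) (even (suc (x + y))) (suc y) y y (trans (swap x y) e) 2≤c c≤ Tb
      (+-suc x y) (m≤n⇒m≤1+n (<⇒≤ x<y)) refl x<y rest
    where
    x<y = double-cancel-< (s≤s⁻¹ a<b)
    Tb : T (suc (y + y)) ≡ T (suc y) + T y + U y
    Tb = trans (Σh-suc-double (suc p) y) (cong (_+ U y) (+-comm (T y) (T (suc y))))
    rest : U x + U y + V x ≤ U (suc (x + y))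
    rest = ≤-trans (+-monoˡ-≤ (V x) (+-monoʳ-≤ (U x) (Σh-mono-suc p y)))
                   (split-p (+-suc x y) (m≤n⇒m≤1+n (<⇒≤ x<y)))
    swap : ∀ x y → suc (x + y) + suc (x + y) ≡ suc (x + x) + suc (y + y)
    swap = solve-∀

  split-≤ n       {zero} {b} refl _ _ = ≤-reflexive (+-identityʳ (T b))
  split-≤ zero    {suc a} refl () _
  split-≤ (suc n) {suc a} {b} e c≤ a≤b with m≤n⇒m<n∨m≡n a≤b
  ... | inj₂ refl = ≤-reflexive (trans (sym (Σh-double (suc p) (suc a))) (cong T e))
  ... | inj₁ a<b  = split-< n (halves (suc a)) (halves b) e 2≤c c≤ a<b
    where
    2≤c = subst (2 ≤_) e (s≤s (≤-trans (≤-trans (s≤s z≤n) (<⇒≤ a<b)) (m≤n+m b a)))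

Σh-split-≤ : ∀ q {a b c} → a + b ≡ c → a ≤ b → Σh q a + Σh q b + Σh⁻ q a ≤ Σh q c
Σh-split-≤ zero {a} {b} refl _ = ≤-reflexive (begin
  Σh 0 a + Σh 0 b + Σh⁻ 0 a  ≡⟨ cong₂ _+_ (cong₂ _+_ (Σh-0 a) (Σh-0 b)) (Σh⁻-0 a) ⟩
  a + b + 0                  ≡⟨ +-identityʳ (a + b) ⟩
  a + b                      ≡⟨ Σh-0 (a + b) ⟨
  Σh 0 (a + b)               ∎)
  where open ≡-Reasoning
Σh-split-≤ (suc p) {c = c} e a≤b = SplitStep.split-≤ p (Σh-split-≤ p) c e ≤-refl a≤b

Σh-split-at-halves : ∀ q {k} (v : Halves k) →
  Σh (suc q) (lo v) + Σh (suc q) (k ∸ lo v) + Σh q (lo v) ≡ Σh (suc q) k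
Σh-split-at-halves q v = trans (cong (λ r → Σh (suc q) (lo v) + Σh (suc q) r + Σh q (lo v)) k∸lo≡hi)
                               (sym (Σh-halves (suc q) v))
  where
  k∸lo≡hi = trans (cong (_∸ lo v) (sym (lo+hi≡ v))) (m+n∸m≡n (lo v) (hi v))

Σh-split-attained : ∀ q {k} → 2 ≤ k →
  ∃[ j ] j < k / 2 × Σh (suc q) (suc j) + Σh (suc q) (k ∸ suc j) + Σh q (suc j) ≡ Σh (suc q) k
Σh-split-attained q {k} = attained (halves k)
  where
  attained : ∀ {k} → Halves k → 2 ≤ k →
    ∃[ j ] j < k / 2 × Σh (suc q) (suc j) + Σh (suc q) (k ∸ suc j) + Σh q (suc j) ≡ Σh (suc q) k
  attained (even (suc x)) _ =
    x , subst (x <_) (sym (/2≡lo (even (suc x)))) ≤-refl , Σh-split-at-halves q (even (suc x))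
  attained (odd zero)     (s≤s ())
  attained (odd (suc x))  _ =
    x , subst (x <_) (sym (/2≡lo (odd (suc x)))) ≤-refl , Σh-split-at-halves q (odd (suc x))

maxL-lub : ∀ {v} xs → All (_≤ v) xs → maxL xs ≤ v
maxL-lub []       []         = z≤n
maxL-lub (x ∷ xs) (x≤v ∷ xs≤v) = ⊔-lub x≤v (maxL-lub xs xs≤v)

∈⇒≤maxL : ∀ {x xs} → x ∈ xs → x ≤ maxL xs
∈⇒≤maxL {xs = y ∷ ys} (here refl) = m≤m⊔n y (maxL ys)
∈⇒≤maxL {xs = y ∷ ys} (there x∈ys) = ≤-trans (∈⇒≤maxL x∈ys) (m≤n⊔m y (maxL ys))

maxL-map-upTo : ∀ m (g : ℕ → ℕ) {v j} → (∀ {i} → i < m → g i ≤ v) → j < m → g j ≡ v →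
  maxL (map g (upTo m)) ≡ v
maxL-map-upTo m g bound j<m gj≡v = ≤-antisym
  (maxL-lub (map g (upTo m)) (All.map⁺ (All.applyUpTo⁺₁ id m bound)))
  (subst (_≤ maxL (map g (upTo m))) gj≡v (∈⇒≤maxL (∈-map⁺ g (∈-upTo⁺ j<m))))

<-/2⇒double≤ : ∀ {j} k → j < k / 2 → suc j + suc j ≤ k
<-/2⇒double≤ {j} k j<k/2 = ≤-trans (+-mono-≤ j<lo j<lo) (lo+lo≤ v)
  where
  v = halves k
  j<lo = subst (j <_) (/2≡lo v) j<k/2

Ff≡Σh : ∀ q fuel k → k ≤ fuel → Ff q fuel k ≡ Σh q k
Ff≡Σh zero    _        k             _ = sym (Σh-0 k)
Ff≡Σh (suc q) zero     zero          _ = refl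
Ff≡Σh (suc q) (suc f)  zero          _ = refl
Ff≡Σh (suc q) (suc f)  (suc zero)    _ = refl
Ff≡Σh (suc q) (suc f)  (suc (suc m)) (s≤s 1+m≤f) with Σh-split-attained q {suc (suc m)} (s≤s (s≤s z≤n))
... | j , j<k/2 , attained =
  maxL-map-upTo (k / 2) split-value bound j<k/2 (trans (split-value≡ j<k/2) attained)
  where
  k = suc (suc m)
  split-value : ℕ → ℕ
  split-value i = Ff (suc q) f (suc i) + Ff (suc q) f (k ∸ suc i) + Ff q f (suc i)
  split-value≡ : ∀ {i} → i < k / 2 →
    split-value i ≡ Σh (suc q) (suc i) + Σh (suc q) (k ∸ suc i) + Σh q (suc i)
  split-value≡ {i} i<k/2 = cong₂ _+_ (cong₂ _+_ (Ff≡Σh (suc q) f (suc i) (≤-trans 1+i≤k-1-i k-1-i≤f))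
                                               (Ff≡Σh (suc q) f (k ∸ suc i) k-1-i≤f))
                                    (Ff≡Σh q f (suc i) (≤-trans 1+i≤k-1-i k-1-i≤f))
    where
    1+i≤k-1-i = m+n≤o⇒m≤o∸n (suc i) (<-/2⇒double≤ k i<k/2)
    k-1-i≤f = ≤-trans (m∸n≤m (suc m) i) 1+m≤f
  bound : ∀ {i} → i < k / 2 → split-value i ≤ Σh (suc q) k
  bound {i} i<k/2 = subst (_≤ Σh (suc q) k) (sym (split-value≡ i<k/2))
    (Σh-split-≤ (suc q) (m+[n∸m]≡n (m+n≤o⇒m≤o (suc i) 2i≤k)) (m+n≤o⇒m≤o∸n (suc i) 2i≤k))
    where
    2i≤k = <-/2⇒double≤ k i<k/2

-- The identity holds for all q and k.
lemma3 : (n : ℕ) → 1 ≤ n → (q k : ℕ) → 1 ≤ q → q ≤ n → 1 ≤ k → k ≤ 2 ^ n →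
    F q k ≡ sumTo k (hq q)
lemma3 _ _ q k _ _ _ _ = trans (Ff≡Σh q k k ≤-refl) (sym (sumTo≡sumBelow k (hq q)))
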